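{- Let $(\Sigma,<)$ be a finite totally ordered alphabet and let $\ell_1,\ldots,\ell_h$ be anti-Lyndon words with $\ell_1\ge_p\ell_2\ge_p\cdots\ge_p\ell_h$. Let $h\ge2$ and let $i,j$ with $1\le i<j\le h$ be such that $\ell_1=\ell_2=\cdots=\ell_i\neq\ell_{i+1}$ and $\ell_{i+1}\cdots\ell_j$ is a prefix of $\ell_1$. Then $\ell_1\ell_2\cdots\ell_{i+1}\cdots\ell_j$ is an inverse Lyndon word.
   Context: $x\ge_p y$ means $y$ is a prefix of $x$. Lexicographic order $\prec$ on $\Sigma^*$: $x\prec y$ if $x$ is a proper prefix of $y$, or $x=ras$, $y=rbt$ with $a,b\in\Sigma$, $a<b$. An inverse Lyndon word is a nonempty word $u$ with $s\prec u$ for each nonempty proper suffix $s$ of $u$. Inverse order $<_{in}$: $b<_{in}a\iff a<b$; $\prec_{in}$ the induced lexicographic order. An anti-Lyndon word is a nonempty primitive word strictly smaller for $\prec_{in}$ than all its other conjugates. -}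

module Defs where

open import Data.Nat using (ℕ; zero; suc)
open import Data.Fin using (Fin) renaming (_<_ to _<ᶠ_)
open import Data.List using (List; []; _∷_; _++_)
open import Data.Product using (Σ; ∃; _×_; _,_)
open import Data.Sum using (_⊎_)
open import Relation.Binary.PropositionalEquality using (_≡_; _≢_)
open import Relation.Nullary using (¬_)

Word : ℕ → Set
Word n = List (Fin n)

_≥ₚ_ : ∀ {n} → Word n → Word n → Set
x ≥ₚ y = ∃ λ z → y ++ z ≡ x

Lex : ∀ {n} → (Fin n → Fin n → Set) → Word n → Word n → Set
Lex {n} R x y =
  (∃ λ (z : Word n) → z ≢ [] × x ++ z ≡ y)
  ⊎ (Σ (Word n) λ r → Σ (Fin n) λ a → Σ (Fin n) λ b → Σ (Word n) λ s → Σ (Word n) λ t →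
       R a b × x ≡ r ++ (a ∷ s) × y ≡ r ++ (b ∷ t))

_≺_ : ∀ {n} → Word n → Word n → Set
_≺_ = Lex _<ᶠ_

_<in_ : ∀ {n} → Fin n → Fin n → Set
b <in a = a <ᶠ b

_≺in_ : ∀ {n} → Word n → Word n → Set
_≺in_ = Lex _<in_

InverseLyndon : ∀ {n} → Word n → Set
InverseLyndon {n} u =
  u ≢ [] × (∀ (p s : Word n) → p ≢ [] → s ≢ [] → u ≡ p ++ s → s ≺ u)

pow : ∀ {n} → Word n → ℕ → Word n
pow v zero = []
pow v (suc k) = v ++ pow v k

Primitive : ∀ {n} → Word n → Set
Primitive {n} u = u ≢ [] × (∀ (v : Word n) (k : ℕ) → u ≡ pow v k → k ≡ 1)

AntiLyndon : ∀ {n} → Word n → Set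
AntiLyndon {n} u =
  u ≢ [] × Primitive u × (∀ (r s : Word n) → u ≡ r ++ s → s ++ r ≢ u → u ≺in (s ++ r))

seg : ∀ {n} → (ℕ → Word n) → ℕ → ℕ → Word n
seg ℓ a zero = []
seg ℓ a (suc k) = ℓ a ++ seg ℓ (suc a) k

{-# OPTIONS --safe #-}
-- With L = ℓ₁ and p = ℓ_{i+1}⋯ℓ_j the word is L^i p, a prefix of L^(i+1).  As L is
-- primitive, every rotation s r of L = r s differs from L, so anti-Lyndon-ness makes s r
-- smaller than L at a letter mismatch; playing two rotations off each other shows that
-- every proper suffix of L is itself smaller than L at a mismatch.  A proper suffix of
-- L^i p, extended to a suffix of L^(i+1), then either begins inside a copy of L, and so
-- is smaller than L (hence than L^i p) at a mismatch, or is a prefix of a power of L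
-- shorter than L^i p, hence a proper prefix of it.
module Submission where

open import Defs
open import Data.Nat using (ℕ; zero; suc; _+_; _∸_; _≤_; _<_; z≤n; s≤s)
open import Data.Nat.Properties
  using (≤-refl; <⇒≤; <-irrefl; <-trans; <-≤-trans; n<1+n; m≤m+n; +-identityʳ; +-suc;
         +-cancelˡ-≡; m+1+n≢0; suc-injective; m+[n∸m]≡n)
open import Data.Fin using (Fin) renaming (_<_ to _<ᶠ_)
open import Data.Fin.Properties using () renaming (<-irrefl to <ᶠ-irrefl; <-asym to <ᶠ-asym)
open import Data.List using (List; []; _∷_; _++_; length)
open import Data.List.Properties
  using (++-assoc; ++-identityʳ; ++-cancelʳ; ++-conicalˡ; ++-conicalʳ; ∷-injective;
         length-++; length-++-comm; length-++-≤ʳ)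
open import Data.Product using (Σ; ∃; ∃₂; _×_; _,_)
open import Data.Sum using (_⊎_; inj₁; inj₂)
open import Data.Empty using (⊥; ⊥-elim)
open import Relation.Binary.PropositionalEquality
  using (_≡_; _≢_; refl; sym; trans; cong; cong₂; subst; module ≡-Reasoning)
open import Relation.Nullary using (¬_)

open ≡-Reasoning

module _ {a} {A : Set a} where

  levi : ∀ (ws : List A) {xs} ys {zs} → ws ++ xs ≡ ys ++ zs →
         (∃ λ m → ys ≡ ws ++ m × xs ≡ m ++ zs) ⊎ (∃ λ m → ws ≡ ys ++ m × zs ≡ m ++ xs)
  levi []       ys       eq = inj₁ (ys , refl , eq)
  levi (w ∷ ws) []       eq = inj₂ (w ∷ ws , refl , sym eq)
  levi (w ∷ ws) (_ ∷ ys) eq with ∷-injective eq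
  ... | refl , eq′ with levi ws ys eq′
  ...   | inj₁ (m , ys≡wsm , xs≡mzs) = inj₁ (m , cong (w ∷_) ys≡wsm , xs≡mzs)
  ...   | inj₂ (m , ws≡ysm , zs≡mxs) = inj₂ (m , cong (w ∷_) ws≡ysm , zs≡mxs)

  length-<-++ʳ : ∀ (r s : List A) → r ≢ [] → length s < length (r ++ s)
  length-<-++ʳ []      s r≢[] = ⊥-elim (r≢[] refl)
  length-<-++ʳ (_ ∷ r) s _    = s≤s (length-++-≤ʳ s {r})

  length-<-++ˡ : ∀ (r s : List A) → s ≢ [] → length r < length (r ++ s)
  length-<-++ˡ r s s≢[] = subst (length r <_) (length-++-comm s r) (length-<-++ʳ s r s≢[])

module _ {n : ℕ} where

  ≥ₚ-trans : ∀ {x y z : Word n} → x ≥ₚ y → y ≥ₚ z → x ≥ₚ z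
  ≥ₚ-trans {z = z} (u , refl) (v , refl) = v ++ u , sym (++-assoc z v u)

  ≥ₚ-byLength : ∀ (a b : Word n) {c} → c ≥ₚ a → c ≥ₚ b → length a ≤ length b → b ≥ₚ a
  ≥ₚ-byLength []      b       _        _        _         = b , refl
  ≥ₚ-byLength (x ∷ a) (y ∷ b) (u , refl) (v , eq) (s≤s a≤b) with ∷-injective eq
  ... | refl , bv≡au with ≥ₚ-byLength a b (u , refl) (v , bv≡au) a≤b
  ...   | w , aw≡b = w , cong (x ∷_) aw≡b

  ≥ₚ-shorter⇒≺ : ∀ {s w : Word n} → w ≥ₚ s → length s < length w → s ≺ w
  ≥ₚ-shorter⇒≺ {s} (z , refl) shorter = inj₁ (z , z≢[] , refl)
    where
    z≢[] : z ≢ []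
    z≢[] refl = <-irrefl (cong length (sym (++-identityʳ s))) shorter

  pow-+ : ∀ (z : Word n) a b → pow z (a + b) ≡ pow z a ++ pow z b
  pow-+ z zero    b = refl
  pow-+ z (suc a) b = trans (cong (z ++_) (pow-+ z a b)) (sym (++-assoc z (pow z a) (pow z b)))

  pow-sucʳ : ∀ (v : Word n) k → pow v (suc k) ≡ pow v k ++ v
  pow-sucʳ v zero    = ++-identityʳ v
  pow-sucʳ v (suc k) = trans (cong (v ++_) (pow-sucʳ v k)) (sym (++-assoc v (pow v k) v))

  CommonRoot : Word n → Word n → Set
  CommonRoot r s = ∃ λ z → ∃₂ λ a b → r ≡ pow z a × s ≡ pow z b

  commonRoot-swap : ∀ {r s} → CommonRoot r s → CommonRoot s r
  commonRoot-swap (z , a , b , r≡zᵃ , s≡zᵇ) = z , b , a , s≡zᵇ , r≡zᵃ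

  commonRoot-++ʳ : ∀ {r m} → CommonRoot r m → CommonRoot r (r ++ m)
  commonRoot-++ʳ (z , a , b , refl , refl) = z , a , a + b , refl , sym (pow-+ z a b)

  commute⇒commonRoot : ∀ (r s : Word n) → r ++ s ≡ s ++ r → CommonRoot r s
  commute⇒commonRoot r s = go (suc (length (r ++ s))) r s ≤-refl
    where
    go : ∀ fuel (r s : Word n) → length (r ++ s) < fuel → r ++ s ≡ s ++ r → CommonRoot r s
    go _       []      s       _ _ = s , 0 , 1 , refl , sym (++-identityʳ s)
    go _       (x ∷ r) []      _ _ = x ∷ r , 1 , 0 , sym (++-identityʳ (x ∷ r)) , refl
    go (suc f) (x ∷ r) (y ∷ s) (s≤s bound) eq with levi (x ∷ r) (y ∷ s) eq
    ... | inj₁ (m , refl , rm≡mr) =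
      commonRoot-++ʳ
        (go f (x ∷ r) m (<-≤-trans (length-<-++ʳ (x ∷ r) ((x ∷ r) ++ m) (λ ())) bound) rm≡mr)
    ... | inj₂ (m , refl , sm≡ms) =
      commonRoot-swap (commonRoot-++ʳ
        (go f (y ∷ s) m (<-≤-trans (length-<-++ˡ ((y ∷ s) ++ m) (y ∷ s) (λ ())) bound) sm≡ms))

  primitive⇒rotation≢ : ∀ {L r s : Word n} → Primitive L → L ≡ r ++ s → r ≢ [] → s ≢ [] →
                        s ++ r ≢ L
  primitive⇒rotation≢ {r = r} {s} (_ , prim) L≡rs r≢[] s≢[] sr≡L
    with commute⇒commonRoot r s (trans (sym L≡rs) (sym sr≡L))
  ... | z , zero  , _     , refl , _    = r≢[] refl
  ... | z , suc _ , zero  , _    , refl = s≢[] refl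
  ... | z , suc a , suc b , r≡zᵃ , s≡zᵇ =
    m+1+n≢0 a (suc-injective (prim z (suc a + suc b)
      (trans L≡rs (trans (cong₂ _++_ r≡zᵃ s≡zᵇ) (sym (pow-+ z (suc a) (suc b)))))))

  infix 4 _⊏_
  data _⊏_ : Word n → Word n → Set where
    here  : ∀ {a b t u} → a <ᶠ b → (a ∷ t) ⊏ (b ∷ u)
    there : ∀ {a t u} → t ⊏ u → (a ∷ t) ⊏ (a ∷ u)

  ⊏⇒≺ : ∀ {x y} → x ⊏ y → x ≺ y
  ⊏⇒≺ x⊏y = inj₂ (mismatch x⊏y)
    where
    mismatch : ∀ {x y} → x ⊏ y → Σ (Word n) λ r → Σ (Fin n) λ a → Σ (Fin n) λ b →
               Σ (Word n) λ s → Σ (Word n) λ t → a <ᶠ b × x ≡ r ++ (a ∷ s) × y ≡ r ++ (b ∷ t)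
    mismatch (here {a} {b} {t} {u} a<b) = [] , a , b , t , u , a<b , refl , refl
    mismatch (there {c} t⊏u) with mismatch t⊏u
    ... | r , a , b , s , t , a<b , refl , refl = c ∷ r , a , b , s , t , a<b , refl , refl

  mismatch⇒⊏ : ∀ r {a b s t x y} → x ≡ r ++ (a ∷ s) → y ≡ r ++ (b ∷ t) → a <ᶠ b → x ⊏ y
  mismatch⇒⊏ []      refl refl a<b = here a<b
  mismatch⇒⊏ (c ∷ r) refl refl a<b = there (mismatch⇒⊏ r refl refl a<b)

  ≺in-sameLength⇒⊏ : ∀ {x y} → length x ≡ length y → y ≺in x → x ⊏ y
  ≺in-sameLength⇒⊏ {y = y} |x|≡|y| (inj₁ (z , z≢[] , refl)) =
    ⊥-elim (<-irrefl (sym |x|≡|y|) (length-<-++ˡ y z z≢[]))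
  ≺in-sameLength⇒⊏ _ (inj₂ (r , _ , _ , _ , _ , b<a , y≡ras , x≡rbt)) =
    mismatch⇒⊏ r x≡rbt y≡ras b<a

  ⊏-irrefl : ∀ {x} → ¬ x ⊏ x
  ⊏-irrefl (here a<a)  = <ᶠ-irrefl refl a<a
  ⊏-irrefl (there x⊏x) = ⊏-irrefl x⊏x

  ⊏-asym : ∀ {x y} → x ⊏ y → ¬ y ⊏ x
  ⊏-asym (here a<b)  (here b<a)  = <ᶠ-asym a<b b<a
  ⊏-asym (here a<a)  (there _)   = <ᶠ-irrefl refl a<a
  ⊏-asym (there _)   (here a<a)  = <ᶠ-irrefl refl a<a
  ⊏-asym (there x⊏y) (there y⊏x) = ⊏-asym x⊏y y⊏x

  ⊏-++ʳ : ∀ {x y z} → x ⊏ y → x ⊏ y ++ z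
  ⊏-++ʳ (here a<b)  = here a<b
  ⊏-++ʳ (there x⊏y) = there (⊏-++ʳ x⊏y)

  ⊏-++ˡ : ∀ {x y z} → x ⊏ y → x ++ z ⊏ y
  ⊏-++ˡ (here a<b)  = here a<b
  ⊏-++ˡ (there x⊏y) = there (⊏-++ˡ x⊏y)

  ⊏-cancelˡ : ∀ s {x y} → s ++ x ⊏ s ++ y → x ⊏ y
  ⊏-cancelˡ []      x⊏y          = x⊏y
  ⊏-cancelˡ (_ ∷ s) (here a<a)   = ⊥-elim (<ᶠ-irrefl refl a<a)
  ⊏-cancelˡ (_ ∷ s) (there sx⊏sy) = ⊏-cancelˡ s sx⊏sy

  ⊏-prefix⁻ : ∀ s {y L} → s ++ y ⊏ L → s ⊏ L ⊎ L ≥ₚ s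
  ⊏-prefix⁻ []      {L = L} _ = inj₂ (L , refl)
  ⊏-prefix⁻ (_ ∷ s) (here a<b) = inj₁ (here a<b)
  ⊏-prefix⁻ (c ∷ s) (there sy⊏L) with ⊏-prefix⁻ s sy⊏L
  ... | inj₁ s⊏L        = inj₁ (there s⊏L)
  ... | inj₂ (z , sz≡L) = inj₂ (z , cong (c ∷_) sz≡L)

  ⊏-prefixes⁻ : ∀ a b {x y} → length a ≡ length b → a ++ x ⊏ b ++ y → a ⊏ b ⊎ a ≡ b
  ⊏-prefixes⁻ []      []      _ _          = inj₂ refl
  ⊏-prefixes⁻ (_ ∷ a) (_ ∷ b) _ (here a<b) = inj₁ (here a<b)
  ⊏-prefixes⁻ (_ ∷ a) (_ ∷ b) |a|≡|b| (there ax⊏by)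
    with ⊏-prefixes⁻ a b (suc-injective |a|≡|b|) ax⊏by
  ... | inj₁ a⊏b  = inj₁ (there a⊏b)
  ... | inj₂ refl = inj₂ refl

  Suffixes⊏ : Word n → Set
  Suffixes⊏ L = ∀ r s → r ≢ [] → s ≢ [] → L ≡ r ++ s → s ⊏ L

  antiLyndon-rotation⊏ : ∀ {L r s : Word n} → AntiLyndon L → L ≡ r ++ s → r ≢ [] → s ≢ [] →
                         s ++ r ⊏ L
  antiLyndon-rotation⊏ {r = r} {s} (_ , prim , minimal) L≡rs r≢[] s≢[] =
    ≺in-sameLength⇒⊏ (trans (length-++-comm s r) (cong length (sym L≡rs)))
      (minimal r s L≡rs (primitive⇒rotation≢ prim L≡rs r≢[] s≢[]))

  -- The rotations s r and u s of L = r s = s u would give r ⊏ u and u ⊑ r.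
  antiLyndon-unbordered : ∀ {L r s u : Word n} → AntiLyndon L → L ≡ r ++ s → L ≡ s ++ u →
                          r ≢ [] → s ≢ [] → ⊥
  antiLyndon-unbordered {r = r} {s} {u} anti L≡rs L≡su r≢[] s≢[] =
    case (⊏-prefixes⁻ u r |u|≡|r|
      (subst (u ++ s ⊏_) L≡rs (antiLyndon-rotation⊏ anti L≡su s≢[] u≢[])))
    where
    u≢[] : u ≢ []
    u≢[] refl = r≢[] (++-cancelʳ s r [] (trans (sym L≡rs) (trans L≡su (++-identityʳ s))))

    |u|≡|r| : length u ≡ length r
    |u|≡|r| = +-cancelˡ-≡ (length s) _ _ (begin
      length s + length u  ≡⟨ sym (length-++ s) ⟩
      length (s ++ u)      ≡⟨ cong length (trans (sym L≡su) L≡rs) ⟩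
      length (r ++ s)      ≡⟨ length-++-comm r s ⟩
      length (s ++ r)      ≡⟨ length-++ s ⟩
      length s + length r  ∎)

    r⊏u : r ⊏ u
    r⊏u = ⊏-cancelˡ s (subst (s ++ r ⊏_) L≡su (antiLyndon-rotation⊏ anti L≡rs r≢[] s≢[]))

    case : u ⊏ r ⊎ u ≡ r → ⊥
    case (inj₁ u⊏r) = ⊏-asym u⊏r r⊏u
    case (inj₂ refl) = ⊏-irrefl r⊏u

  antiLyndon⇒suffixes⊏ : ∀ {L : Word n} → AntiLyndon L → Suffixes⊏ L
  antiLyndon⇒suffixes⊏ anti r s r≢[] s≢[] L≡rs
    with ⊏-prefix⁻ s (antiLyndon-rotation⊏ anti L≡rs r≢[] s≢[])
  ... | inj₁ s⊏L        = s⊏L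
  ... | inj₂ (u , su≡L) = ⊥-elim (antiLyndon-unbordered anti L≡rs (sym su≡L) r≢[] s≢[])

  powerSuffix-inFirstCopy : ∀ {L : Word n} → Suffixes⊏ L → ∀ k p m → L ≡ p ++ m →
                            pow L (suc k) ≥ₚ (m ++ pow L k) ⊎ m ++ pow L k ⊏ L
  powerSuffix-inFirstCopy {L} _ k [] m L≡m =
    inj₁ ([] , trans (++-identityʳ _) (cong (_++ pow L k) (sym L≡m)))
  powerSuffix-inFirstCopy {L} _ k (_ ∷ _) [] _ = inj₁ (L , sym (pow-sucʳ L k))
  powerSuffix-inFirstCopy below k (x ∷ p) (y ∷ m) L≡pm =
    inj₂ (⊏-++ˡ (below (x ∷ p) (y ∷ m) (λ ()) (λ ()) L≡pm))

  powerSuffix⇒prefix⊎⊏ : ∀ {L : Word n} → Suffixes⊏ L → ∀ k p s → pow L k ≡ p ++ s →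
                         pow L k ≥ₚ s ⊎ s ⊏ L
  powerSuffix⇒prefix⊎⊏ _ zero p s []≡ps with ++-conicalʳ p s (sym []≡ps)
  ... | refl = inj₁ ([] , refl)
  powerSuffix⇒prefix⊎⊏ {L} below (suc k) p s Lᵏ⁺¹≡ps with levi L p Lᵏ⁺¹≡ps
  ... | inj₂ (m , L≡pm , refl) = powerSuffix-inFirstCopy below k p m L≡pm
  ... | inj₁ (m , _ , Lᵏ≡ms) with powerSuffix⇒prefix⊎⊏ below k m s Lᵏ≡ms
  ...   | inj₁ Lᵏ≥s = inj₁ (≥ₚ-trans (L , sym (pow-sucʳ L k)) Lᵏ≥s)
  ...   | inj₂ s⊏L  = inj₂ s⊏L

  suffixes⊏⇒prefixOfPower-inverseLyndon : ∀ {L w : Word n} → L ≢ [] → Suffixes⊏ L → ∀ m →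
                                          w ≥ₚ L → pow L m ≥ₚ w → InverseLyndon w
  suffixes⊏⇒prefixOfPower-inverseLyndon {L} L≢[] below m (v , refl) (y , wy≡Lᵐ) =
    (λ Lv≡[] → L≢[] (++-conicalˡ L v Lv≡[])) , suffix≺
    where
    Lᵐ≥L : pow L m ≥ₚ L
    Lᵐ≥L = ≥ₚ-trans (y , wy≡Lᵐ) (v , refl)

    suffix≺ : ∀ p s → p ≢ [] → s ≢ [] → L ++ v ≡ p ++ s → s ≺ (L ++ v)
    suffix≺ p s p≢[] _ w≡ps = cases (powerSuffix⇒prefix⊎⊏ below m p (s ++ y) Lᵐ≡psy)
      where
      Lᵐ≡psy : pow L m ≡ p ++ (s ++ y)
      Lᵐ≡psy = begin
        pow L m          ≡⟨ sym wy≡Lᵐ ⟩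
        (L ++ v) ++ y    ≡⟨ cong (_++ y) w≡ps ⟩
        (p ++ s) ++ y    ≡⟨ ++-assoc p s y ⟩
        p ++ (s ++ y)    ∎

      shorter : length s < length (L ++ v)
      shorter = subst (λ w → length s < length w) (sym w≡ps) (length-<-++ʳ p s p≢[])

      prefix⇒≺ : pow L m ≥ₚ s → s ≺ (L ++ v)
      prefix⇒≺ Lᵐ≥s =
        ≥ₚ-shorter⇒≺ (≥ₚ-byLength s (L ++ v) Lᵐ≥s (y , wy≡Lᵐ) (<⇒≤ shorter)) shorter

      cases : pow L m ≥ₚ (s ++ y) ⊎ s ++ y ⊏ L → s ≺ (L ++ v)
      cases (inj₁ Lᵐ≥sy) = prefix⇒≺ (≥ₚ-trans Lᵐ≥sy (y , refl))
      cases (inj₂ sy⊏L) with ⊏-prefix⁻ s sy⊏L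
      ... | inj₁ s⊏L = ⊏⇒≺ (⊏-++ʳ s⊏L)
      ... | inj₂ L≥s = prefix⇒≺ (≥ₚ-trans Lᵐ≥L L≥s)

  antiLyndon-pow++prefix-inverseLyndon : ∀ {L P : Word n} → AntiLyndon L → L ≥ₚ P → ∀ k →
                                         InverseLyndon (pow L (suc k) ++ P)
  antiLyndon-pow++prefix-inverseLyndon {L} {P} anti@(L≢[] , _) (y , Py≡L) k =
    suffixes⊏⇒prefixOfPower-inverseLyndon L≢[] (antiLyndon⇒suffixes⊏ anti) (suc (suc k))
      (pow L k ++ P , sym (++-assoc L (pow L k) P))
      (y , (begin
        (pow L (suc k) ++ P) ++ y  ≡⟨ ++-assoc (pow L (suc k)) P y ⟩
        pow L (suc k) ++ (P ++ y)  ≡⟨ cong (pow L (suc k) ++_) Py≡L ⟩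
        pow L (suc k) ++ L         ≡⟨ sym (pow-sucʳ L (suc k)) ⟩
        pow L (suc (suc k))        ∎))

seg-++ : ∀ {n} (ℓ : ℕ → Word n) a m k → seg ℓ a (m + k) ≡ seg ℓ a m ++ seg ℓ (a + m) k
seg-++ ℓ a zero    k = cong (λ b → seg ℓ b k) (sym (+-identityʳ a))
seg-++ ℓ a (suc m) k = begin
  ℓ a ++ seg ℓ (suc a) (m + k)
    ≡⟨ cong (ℓ a ++_) (seg-++ ℓ (suc a) m k) ⟩
  ℓ a ++ (seg ℓ (suc a) m ++ seg ℓ (suc a + m) k)
    ≡⟨ sym (++-assoc (ℓ a) _ _) ⟩
  (ℓ a ++ seg ℓ (suc a) m) ++ seg ℓ (suc a + m) k
    ≡⟨ cong (λ b → (ℓ a ++ seg ℓ (suc a) m) ++ seg ℓ b k) (sym (+-suc a m)) ⟩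
  (ℓ a ++ seg ℓ (suc a) m) ++ seg ℓ (a + suc m) k  ∎

seg-constant : ∀ {n} (ℓ : ℕ → Word n) {L} a m → (∀ k → a < k → k ≤ a + m → ℓ k ≡ L) →
               seg ℓ (suc a) m ≡ pow L m
seg-constant ℓ a zero    _     = refl
seg-constant ℓ a (suc m) ℓₖ≡L = cong₂ _++_
  (ℓₖ≡L (suc a) ≤-refl (subst (suc a ≤_) (sym (+-suc a m)) (s≤s (m≤m+n a m))))
  (seg-constant ℓ (suc a) m λ k 1+a<k k≤1+a+m →
    ℓₖ≡L k (<-trans (n<1+n a) 1+a<k) (subst (k ≤_) (sym (+-suc a m)) k≤1+a+m))

proposition9p3 : (n : ℕ) (h : ℕ) (ℓ : ℕ → Word n)
    → 2 ≤ h
    → (∀ k → 1 ≤ k → k ≤ h → AntiLyndon (ℓ k))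
    → (∀ k → 1 ≤ k → k < h → ℓ k ≥ₚ ℓ (suc k))
    → (i j : ℕ) → 1 ≤ i → i < j → j ≤ h
    → (∀ k → 1 ≤ k → k ≤ i → ℓ k ≡ ℓ 1)
    → ℓ i ≢ ℓ (suc i)
    → ℓ 1 ≥ₚ seg ℓ (suc i) (j ∸ i)
    → InverseLyndon (seg ℓ 1 j)
proposition9p3 n _ ℓ 2≤h antiLyndon _ (suc i) j (s≤s z≤n) i<j _ ℓk≡ℓ₁ _ ℓ₁≥p =
  subst InverseLyndon (sym word≡)
    (antiLyndon-pow++prefix-inverseLyndon (antiLyndon 1 ≤-refl (<⇒≤ 2≤h)) ℓ₁≥p i)
  where
  p : Word n
  p = seg ℓ (2 + i) (j ∸ suc i)

  word≡ : seg ℓ 1 j ≡ pow (ℓ 1) (suc i) ++ p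
  word≡ = begin
    seg ℓ 1 j                      ≡⟨ cong (seg ℓ 1) (sym (m+[n∸m]≡n (<⇒≤ i<j))) ⟩
    seg ℓ 1 (suc i + (j ∸ suc i))  ≡⟨ seg-++ ℓ 1 (suc i) (j ∸ suc i) ⟩
    seg ℓ 1 (suc i) ++ p           ≡⟨ cong (_++ p) (seg-constant ℓ 0 (suc i) ℓk≡ℓ₁) ⟩
    pow (ℓ 1) (suc i) ++ p         ∎
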